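{- Let $m,n\geq 3$, let $D$ be a $2$-dominating set of the grid graph $G_{m,n}$, and let $2\leq j\leq n-1$. For $t\in[n]$ write $c_t(D)=|D\cap C_t|$. If $D\cap C_j=\{(i,j)\}$ for some $i\in\{1,2,m-1,m\}$, then $c_{j-1}(D)+c_{j+1}(D)\geq 2m-3$.
   Context: For a graph $G$, a set $D\subseteq V(G)$ is a $2$-dominating set if every vertex not in $D$ has at least $2$ neighbours in $D$. The grid graph $G_{m,n}=P_m\times P_n$ has vertex set $[m]\times[n]$ (where $[k]=\{1,\dots,k\}$), with $(i,j)$ and $(i',j')$ adjacent iff $|i-i'|+|j-j'|=1$. For $t\in[n]$, the $t$-th column is $C_t=\{(i,t)\mid i\in[m]\}$. -}

module Defs where

open import Data.Nat using (ℕ; _+_; ∣_-_∣)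
open import Data.Bool using (Bool; true; false)
open import Data.Fin using (Fin; toℕ)
open import Data.Fin.Subset using (Subset; _∈_; _∉_; ∣_∣)
open import Data.Product using (_×_; Σ; ∃; ∃-syntax; _,_)
open import Data.Vec using (tabulate)
open import Relation.Binary.PropositionalEquality using (_≡_; _≢_)

-- Vertices of the grid graph G_{m,n} = P_m × P_n: pairs (i , j) with
-- i : Fin m (row, 0-indexed) and j : Fin n (column, 0-indexed).
Vertex : ℕ → ℕ → Set
Vertex m n = Fin m × Fin n

Adj : ∀ {m n} → Vertex m n → Vertex m n → Set
Adj (i , j) (i' , j') = ∣ toℕ i - toℕ i' ∣ + ∣ toℕ j - toℕ j' ∣ ≡ 1

VSet : ℕ → ℕ → Set
VSet m n = Fin m → Fin n → Bool

_∈D_ : ∀ {m n} → Vertex m n → VSet m n → Set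
(i , j) ∈D D = D i j ≡ true

_∉D_ : ∀ {m n} → Vertex m n → VSet m n → Set
(i , j) ∉D D = D i j ≡ false

TwoDominating : ∀ {m n} → VSet m n → Set
TwoDominating {m} {n} D =
  (v : Vertex m n) → v ∉D D →
  Σ (Vertex m n) λ u → Σ (Vertex m n) λ w →
    u ≢ w × Adj v u × Adj v w × u ∈D D × w ∈D D

colSubset : ∀ {m n} → VSet m n → Fin n → Subset m
colSubset D t = tabulate (λ i → D i t)

c : ∀ {m n} → VSet m n → Fin n → ℕ
c D t = ∣ colSubset D t ∣

-- Let W r = [(r , j-1) ∈ D] + [(r , j+1) ∈ D], so that c_{j-1} + c_{j+1} = Σ_r W r.
-- For r ≠ i the vertex (r , j) is not in D, and of its two D-neighbours only (i , j) can lie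
-- outside row r; hence W r ≥ 1 when r ≠ i and W r ≥ 2 when |r - i| ≥ 2. Turning the grid
-- upside down we may assume i is the first or second row. If it is the first, rows 1, 2, 3
-- contribute at least 0 + 1 + 2. If it is the second, row 1 has no neighbouring row but i, so
-- for k = j ± 1 a missing (1 , k) forces (2 , k) into D: rows 1 and 2 contribute at least 2,
-- row 3 at least 1. The remaining m - 3 rows contribute 2 each. Only D ∩ C_j ⊆ {(i , j)} is used.
module Submission where

open import Defs
open import Data.Bool using (Bool; true; false)
open import Data.Fin using (Fin; toℕ; zero; suc; opposite)
open import Data.Fin.Patterns using (0F; 1F; 2F)
open import Data.Fin.Permutation using (reverse)
open import Data.Fin.Properties using (toℕ-injective; toℕ<n; opposite-prop; opposite-involutive)
open import Data.Fin.Subset using (∣_∣)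
open import Data.Nat using (ℕ; zero; suc; _+_; _*_; _∸_; _≤_; z≤n; s≤s; ∣_-_∣)
open import Data.Nat.Properties
open import Algebra.Properties.CommutativeSemigroup +-commutativeSemigroup using (interchange)
open import Algebra.Properties.CommutativeMonoid.Sum +-0-commutativeMonoid
  using (sum; sum-permute; ∑-distrib-+)
open import Data.Product using (_×_; _,_; proj₁; proj₂)
open import Data.Sum using (_⊎_; inj₁; inj₂; [_,_]′)
open import Data.Vec using (tabulate)
open import Data.Vec.Functional using (Vector)
open import Function using (_∘_; id)
open import Relation.Binary.PropositionalEquality
open import Relation.Nullary using (contradiction)

indicator : Bool → ℕ
indicator true  = 1
indicator false = 0

1≤indicator+indicator : ∀ {a b} → a ≡ true ⊎ b ≡ true → 1 ≤ indicator a + indicator b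
1≤indicator+indicator         (inj₁ refl) = s≤s z≤n
1≤indicator+indicator {a = a} (inj₂ refl) = m≤n+m 1 (indicator a)

∣tabulate∣≡sum : ∀ {k} (f : Fin k → Bool) → ∣ tabulate f ∣ ≡ sum (indicator ∘ f)
∣tabulate∣≡sum {zero}  f = refl
∣tabulate∣≡sum {suc k} f with f zero
... | true  = cong suc (∣tabulate∣≡sum (f ∘ suc))
... | false = ∣tabulate∣≡sum (f ∘ suc)

2*n≤sum : ∀ {n} (f : Vector ℕ n) → (∀ r → 2 ≤ f r) → 2 * n ≤ sum f
2*n≤sum {zero}  f 2≤f = z≤n
2*n≤sum {suc n} f 2≤f = subst (_≤ sum f) (sym (*-suc 2 n))
  (+-mono-≤ (2≤f zero) (2*n≤sum (f ∘ suc) (2≤f ∘ suc)))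

sum≥2*n∸3 : ∀ {k} (f : Vector ℕ (3 + k)) →
  3 ≤ f 0F + f 1F + f 2F → (∀ r → 2 ≤ f (suc (suc (suc r)))) →
  2 * (3 + k) ∸ 3 ≤ sum f
sum≥2*n∸3 {k} f window 2≤rest = begin
  2 * (3 + k) ∸ 3                      ≡⟨ cong (_∸ 3) (*-distribˡ-+ 2 3 k) ⟩
  3 + 2 * k                            ≤⟨ +-mono-≤ window (2*n≤sum _ 2≤rest) ⟩
  f 0F + f 1F + f 2F + sum rest       ≡⟨ regroup ⟩
  sum f                                ∎
  where
  open ≤-Reasoning
  rest : Vector ℕ k
  rest r = f (suc (suc (suc r)))
  regroup : f 0F + f 1F + f 2F + sum rest ≡ sum f
  regroup = trans (+-assoc (f 0F + f 1F) _ _) (+-assoc (f 0F) _ _)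

m+n≤o⇒n≤∣o-m∣ : ∀ m {n o} → m + n ≤ o → n ≤ ∣ o - m ∣
m+n≤o⇒n≤∣o-m∣ zero    {o = o} n≤o = subst (_ ≤_) (sym (∣-∣-identityʳ o)) n≤o
m+n≤o⇒n≤∣o-m∣ (suc m) (s≤s le) = m+n≤o⇒n≤∣o-m∣ m le

∣m-n∣≡1⇒m≡1+n⊎n≡1+m : ∀ {m n} → ∣ m - n ∣ ≡ 1 → m ≡ suc n ⊎ n ≡ suc m
∣m-n∣≡1⇒m≡1+n⊎n≡1+m {zero}  {n}     eq = inj₂ eq
∣m-n∣≡1⇒m≡1+n⊎n≡1+m {suc m} {zero}  eq = inj₁ eq
∣m-n∣≡1⇒m≡1+n⊎n≡1+m {suc m} {suc n} eq with ∣m-n∣≡1⇒m≡1+n⊎n≡1+m {m} {n} eq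
... | inj₁ m≡1+n = inj₁ (cong suc m≡1+n)
... | inj₂ n≡1+m = inj₂ (cong suc n≡1+m)

∣m-·∣≡1-pigeonhole : ∀ {m a b c} → ∣ m - a ∣ ≡ 1 → ∣ m - b ∣ ≡ 1 → ∣ m - c ∣ ≡ 1 →
  a ≡ b ⊎ a ≡ c ⊎ b ≡ c
∣m-·∣≡1-pigeonhole {m} {a} {b} {c} ma mb mc
  with ∣m-n∣≡1⇒m≡1+n⊎n≡1+m {m} {a} ma | ∣m-n∣≡1⇒m≡1+n⊎n≡1+m {m} {b} mb
     | ∣m-n∣≡1⇒m≡1+n⊎n≡1+m {m} {c} mc
... | inj₁ refl | inj₁ eq   | _         = inj₁ (suc-injective eq)
... | inj₂ refl | inj₂ refl | _         = inj₁ refl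
... | inj₁ refl | inj₂ _    | inj₁ eq   = inj₂ (inj₁ (suc-injective eq))
... | inj₁ _    | inj₂ refl | inj₂ refl = inj₂ (inj₂ refl)
... | inj₂ refl | inj₁ refl | inj₂ refl = inj₂ (inj₁ refl)
... | inj₂ _    | inj₁ refl | inj₁ eq   = inj₂ (inj₂ (suc-injective eq))

m+n≡o+p⇒∣m-o∣≡∣n-p∣ : ∀ {m n o p} → m + n ≡ o + p → ∣ m - o ∣ ≡ ∣ n - p ∣
m+n≡o+p⇒∣m-o∣≡∣n-p∣ {m} {n} {o} {p} eq = begin
  ∣ m - o ∣             ≡⟨ sym (∣m+n-m+o∣≡∣n-o∣ n m o) ⟩
  ∣ n + m - n + o ∣     ≡⟨ cong₂ ∣_-_∣ (trans (+-comm n m) eq) (+-comm n o) ⟩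
  ∣ o + p - o + n ∣     ≡⟨ ∣m+n-m+o∣≡∣n-o∣ o p n ⟩
  ∣ p - n ∣             ≡⟨ ∣-∣-comm p n ⟩
  ∣ n - p ∣             ∎
  where open ≡-Reasoning

Adj⇒sameRow⊎sameColumn : ∀ {m n} {r r' : Fin m} {k k' : Fin n} → Adj (r , k) (r' , k') →
  (r ≡ r' × ∣ toℕ k - toℕ k' ∣ ≡ 1) ⊎ (k ≡ k' × ∣ toℕ r - toℕ r' ∣ ≡ 1)
Adj⇒sameRow⊎sameColumn {r = r} {r'} {k} {k'} adj with ∣ toℕ r - toℕ r' ∣ in eq
... | 0 = inj₁ (toℕ-injective (∣m-n∣≡0⇒m≡n eq) , adj)
... | 1 = inj₂ (toℕ-injective (∣m-n∣≡0⇒m≡n (+-cancelˡ-≡ 1 _ _ adj)) , refl)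

toℕ-opposite+1+toℕ : ∀ {m} (r : Fin m) → toℕ (opposite r) + suc (toℕ r) ≡ m
toℕ-opposite+1+toℕ r = trans (cong (_+ suc (toℕ r)) (opposite-prop r)) (m∸n+n≡m (toℕ<n r))

∣opposite-opposite∣≡∣-∣ : ∀ {m} (r r' : Fin m) →
  ∣ toℕ (opposite r) - toℕ (opposite r') ∣ ≡ ∣ toℕ r - toℕ r' ∣
∣opposite-opposite∣≡∣-∣ r r' =
  m+n≡o+p⇒∣m-o∣≡∣n-p∣ {n = suc (toℕ r)} {p = suc (toℕ r')}
    (trans (toℕ-opposite+1+toℕ r) (sym (toℕ-opposite+1+toℕ r')))

toℕ-opposite : ∀ {m} (r : Fin m) {a} → toℕ r + suc a ≡ m → toℕ (opposite r) ≡ a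
toℕ-opposite r {a} eq = +-cancelʳ-≡ (suc (toℕ r)) _ _
  (trans (toℕ-opposite+1+toℕ r)
    (trans (sym eq) (trans (+-comm (toℕ r) (suc a)) (sym (+-suc a (toℕ r))))))

reflectVertex : ∀ {m n} → Vertex m n → Vertex m n
reflectVertex (r , k) = opposite r , k

reflectVertex-involutive : ∀ {m n} (v : Vertex m n) → reflectVertex (reflectVertex v) ≡ v
reflectVertex-involutive (r , k) = cong (_, k) (opposite-involutive r)

Adj-reflectVertex : ∀ {m n} (u v : Vertex m n) → Adj u v → Adj (reflectVertex u) (reflectVertex v)
Adj-reflectVertex (r , k) (r' , k') =
  trans (cong (_+ ∣ toℕ k - toℕ k' ∣) (∣opposite-opposite∣≡∣-∣ r r'))

reflectRows : ∀ {m n} → VSet m n → VSet m n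
reflectRows D r = D (opposite r)

reflectRows-TwoDominating : ∀ {m n} {D : VSet m n} → TwoDominating D → TwoDominating (reflectRows D)
reflectRows-TwoDominating {D = D} dom v v∉ with dom (reflectVertex v) v∉
... | u , w , u≢w , adj-u , adj-w , u∈ , w∈ =
  reflectVertex u , reflectVertex w , reflected-distinct ,
  back adj-u , back adj-w , back∈ u u∈ , back∈ w w∈
  where
  back : ∀ {x} → Adj (reflectVertex v) x → Adj v (reflectVertex x)
  back {x} adj = subst (λ y → Adj y (reflectVertex x)) (reflectVertex-involutive v)
    (Adj-reflectVertex (reflectVertex v) x adj)
  back∈ : ∀ x → x ∈D D → reflectVertex x ∈D reflectRows D
  back∈ x = subst (_∈D D) (sym (reflectVertex-involutive x))
  reflected-distinct : reflectVertex u ≢ reflectVertex w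
  reflected-distinct eq = u≢w (begin
    u                               ≡⟨ sym (reflectVertex-involutive u) ⟩
    reflectVertex (reflectVertex u) ≡⟨ cong reflectVertex eq ⟩
    reflectVertex (reflectVertex w) ≡⟨ reflectVertex-involutive w ⟩
    w                               ∎)
    where open ≡-Reasoning

c-reflectRows : ∀ {m n} (D : VSet m n) t → c (reflectRows D) t ≡ c D t
c-reflectRows {m} D t = begin
  c (reflectRows D) t                     ≡⟨ ∣tabulate∣≡sum (λ r → D (opposite r) t) ⟩
  sum (λ r → indicator (D (opposite r) t)) ≡⟨ sum-permute (λ r → indicator (D r t)) (reverse {m}) ⟨
  sum (λ r → indicator (D r t))           ≡⟨ ∣tabulate∣≡sum (λ r → D r t) ⟨
  c D t                                   ∎
  where open ≡-Reasoning

ColumnMeetsOnly : ∀ {m n} → VSet m n → Fin n → Fin m → Set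
ColumnMeetsOnly {m} D j i = (r : Fin m) → D r j ≡ true → r ≡ i

reflectRows-ColumnMeetsOnly : ∀ {m n} {D : VSet m n} {j i} →
  ColumnMeetsOnly D j i → ColumnMeetsOnly (reflectRows D) j (opposite i)
reflectRows-ColumnMeetsOnly only r r∈ =
  trans (sym (opposite-involutive r)) (cong opposite (only (opposite r) r∈))

module SingletonColumn {m n} {D : VSet m n} (dom : TwoDominating D)
  {j j- j+ : Fin n} (j-+1≡j : toℕ j- + 1 ≡ toℕ j) (j+1≡j+ : toℕ j + 1 ≡ toℕ j+)
  {i : Fin m} (only : ColumnMeetsOnly D j i) where

  weight : Fin m → ℕ
  weight r = indicator (D r j-) + indicator (D r j+)

  c+c≡sum-weight : c D j- + c D j+ ≡ sum weight
  c+c≡sum-weight = trans (cong₂ _+_ (∣tabulate∣≡sum (λ r → D r j-)) (∣tabulate∣≡sum (λ r → D r j+)))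
                         (sym (∑-distrib-+ (λ r → indicator (D r j-)) (λ r → indicator (D r j+))))

  ∉column : ∀ {r} → r ≢ i → D r j ≡ false
  ∉column {r} r≢i with D r j in r∈
  ... | true  = contradiction (only r r∈) r≢i
  ... | false = refl

  ∣j-·∣≡1⇒j-⊎j+ : ∀ {k} → ∣ toℕ j - toℕ k ∣ ≡ 1 → k ≡ j- ⊎ k ≡ j+
  ∣j-·∣≡1⇒j-⊎j+ {k} d with ∣m-n∣≡1⇒m≡1+n⊎n≡1+m d
  ... | inj₁ j≡1+k = inj₁ (toℕ-injective (+-cancelʳ-≡ 1 _ _
          (trans (+-comm (toℕ k) 1) (trans (sym j≡1+k) (sym j-+1≡j)))))
  ... | inj₂ k≡1+j = inj₂ (toℕ-injective (trans k≡1+j (trans (+-comm 1 (toℕ j)) j+1≡j+)))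

  ∣j±-j∣≡1 : ∣ toℕ j- - toℕ j ∣ ≡ 1 × ∣ toℕ j+ - toℕ j ∣ ≡ 1
  ∣j±-j∣≡1 = subst (λ x → ∣ toℕ j- - x ∣ ≡ 1) j-+1≡j (∣m-m+n∣≡n (toℕ j-) 1)
          , subst (λ x → ∣ x - toℕ j ∣ ≡ 1) j+1≡j+
              (trans (∣-∣-comm (toℕ j + 1) (toℕ j)) (∣m-m+n∣≡n (toℕ j) 1))

  column-D-neighbour : ∀ r {u} → Adj (r , j) u → u ∈D D →
    u ≡ (r , j-) ⊎ u ≡ (r , j+) ⊎ (u ≡ (i , j) × ∣ toℕ r - toℕ i ∣ ≡ 1)
  column-D-neighbour r {r' , k'} adj u∈ with Adj⇒sameRow⊎sameColumn {r = r} {r'} {j} {k'} adj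
  ... | inj₁ (refl , d) with ∣j-·∣≡1⇒j-⊎j+ d
  ...   | inj₁ refl = inj₁ refl
  ...   | inj₂ refl = inj₂ (inj₁ refl)
  column-D-neighbour r {r' , k'} adj u∈ | inj₂ (refl , d) with only r' u∈
  ... | refl = inj₂ (inj₂ (refl , d))

  2≤weight-of-both : ∀ {r} → D r j- ≡ true → D r j+ ≡ true → 2 ≤ weight r
  2≤weight-of-both r∈ r∈′ rewrite r∈ | r∈′ = ≤-refl

  weight-off-row : ∀ {r} → r ≢ i → 2 ≤ weight r ⊎ (1 ≤ weight r × ∣ toℕ r - toℕ i ∣ ≡ 1)
  weight-off-row {r} r≢i with dom (r , j) (∉column r≢i)
  ... | u , w , u≢w , adj-u , adj-w , u∈ , w∈
      with column-D-neighbour r adj-u u∈ | column-D-neighbour r adj-w w∈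
  ... | inj₁ refl               | inj₁ refl               = contradiction refl u≢w
  ... | inj₁ refl               | inj₂ (inj₁ refl)        = inj₁ (2≤weight-of-both u∈ w∈)
  ... | inj₁ refl               | inj₂ (inj₂ (refl , d))  = inj₂ (1≤indicator+indicator (inj₁ u∈) , d)
  ... | inj₂ (inj₁ refl)        | inj₁ refl               = inj₁ (2≤weight-of-both w∈ u∈)
  ... | inj₂ (inj₁ refl)        | inj₂ (inj₁ refl)        = contradiction refl u≢w
  ... | inj₂ (inj₁ refl)        | inj₂ (inj₂ (refl , d))  = inj₂ (1≤indicator+indicator (inj₂ u∈) , d)
  ... | inj₂ (inj₂ (refl , d))  | inj₁ refl               = inj₂ (1≤indicator+indicator (inj₁ w∈) , d)
  ... | inj₂ (inj₂ (refl , d))  | inj₂ (inj₁ refl)        = inj₂ (1≤indicator+indicator (inj₂ w∈) , d)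
  ... | inj₂ (inj₂ (refl , _))  | inj₂ (inj₂ (refl , _))  = contradiction refl u≢w

  1≤weight : ∀ {r} → r ≢ i → 1 ≤ weight r
  1≤weight r≢i with weight-off-row r≢i
  ... | inj₁ 2≤w       = ≤-trans (s≤s z≤n) 2≤w
  ... | inj₂ (1≤w , _) = 1≤w

  2≤weight : ∀ {r} → toℕ i + 2 ≤ toℕ r → 2 ≤ weight r
  2≤weight {r} i+2≤r = [ id , (λ (_ , d) → contradiction (subst (2 ≤_) d 2≤∣r-i∣) λ { (s≤s ()) }) ]′
    (weight-off-row r≢i)
    where
    2≤∣r-i∣ : 2 ≤ ∣ toℕ r - toℕ i ∣
    2≤∣r-i∣ = m+n≤o⇒n≤∣o-m∣ (toℕ i) i+2≤r
    r≢i : r ≢ i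
    r≢i refl = contradiction (subst (2 ≤_) (∣n-n∣≡0 (toℕ i)) 2≤∣r-i∣) λ ()

  D-neighbour-of-edge : ∀ {e} → e ≢ i → (∀ r → ∣ toℕ e - toℕ r ∣ ≡ 1 → r ≡ i) →
    ∀ {k u} → Adj (e , k) u → u ∈D D →
    u ≡ (i , k) ⊎ (proj₁ u ≡ e × ∣ toℕ k - toℕ (proj₂ u) ∣ ≡ 1 × proj₂ u ≢ j)
  D-neighbour-of-edge {e} e≢i e-only {k} {r' , k'} adj u∈
    with Adj⇒sameRow⊎sameColumn {r = e} {r'} {k} {k'} adj
  ... | inj₁ (refl , d) = inj₂ (refl , d , λ { refl → e≢i (only e u∈) })
  ... | inj₂ (refl , d) with e-only r' d
  ...   | refl = inj₁ refl

  -- (e , j) ∉ D, so a vertex (e , k) ∉ D has at most one D-neighbour in row e.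
  edge-covered : ∀ {e} → e ≢ i → (∀ r → ∣ toℕ e - toℕ r ∣ ≡ 1 → r ≡ i) →
    ∀ {k} → ∣ toℕ k - toℕ j ∣ ≡ 1 → D e k ≡ true ⊎ D i k ≡ true
  edge-covered {e} e≢i e-only {k} d with D e k in e∉
  ... | true = inj₁ refl
  ... | false with dom (e , k) e∉
  ... | u , w , u≢w , adj-u , adj-w , u∈ , w∈
      with D-neighbour-of-edge e≢i e-only {k} adj-u u∈ | D-neighbour-of-edge e≢i e-only {k} adj-w w∈
  ... | inj₁ refl                | _                        = inj₂ u∈
  ... | inj₂ _                   | inj₁ refl                = inj₂ w∈
  ... | inj₂ (refl , du , u≢j)   | inj₂ (refl , dw , w≢j)   with ∣m-·∣≡1-pigeonhole {toℕ k} du dw d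
  ...   | inj₁ u≡w       = contradiction (cong (e ,_) (toℕ-injective u≡w)) u≢w
  ...   | inj₂ (inj₁ u≡j) = contradiction (toℕ-injective u≡j) u≢j
  ...   | inj₂ (inj₂ w≡j) = contradiction (toℕ-injective w≡j) w≢j

  2≤weight+weight : ∀ {e} → e ≢ i → (∀ r → ∣ toℕ e - toℕ r ∣ ≡ 1 → r ≡ i) → 2 ≤ weight e + weight i
  2≤weight+weight {e} e≢i e-only = subst (2 ≤_) (interchange (indicator (D e j-)) _ _ _)
    (+-mono-≤ (1≤indicator+indicator (edge-covered e≢i e-only (proj₁ ∣j±-j∣≡1)))
              (1≤indicator+indicator (edge-covered e≢i e-only (proj₂ ∣j±-j∣≡1))))

bound-for-top-rows : ∀ {k n} {D : VSet (3 + k) n} → TwoDominating D →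
  ∀ {j j- j+ : Fin n} → toℕ j- + 1 ≡ toℕ j → toℕ j + 1 ≡ toℕ j+ →
  ∀ {i} → i ≡ 0F ⊎ i ≡ 1F → ColumnMeetsOnly D j i → 2 * (3 + k) ∸ 3 ≤ c D j- + c D j+
bound-for-top-rows {k} {D = D} dom {j- = j- } {j+} j-+1≡j j+1≡j+ {i} i≡0⊎1 only = begin
  2 * (3 + k) ∸ 3  ≤⟨ sum≥2*n∸3 weight (window i≡0⊎1) (λ r → 2≤weight (i+2≤3+r i≡0⊎1 r)) ⟩
  sum weight       ≡⟨ c+c≡sum-weight ⟨
  c D j- + c D j+  ∎
  where
  open SingletonColumn dom j-+1≡j j+1≡j+ only
  open ≤-Reasoning

  i+2≤3+r : i ≡ 0F ⊎ i ≡ 1F → ∀ r → toℕ i + 2 ≤ 3 + toℕ r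
  i+2≤3+r (inj₁ refl) r = m≤n⇒m≤1+n (m≤m+n 2 (toℕ r))
  i+2≤3+r (inj₂ refl) r = m≤m+n 3 (toℕ r)

  window : i ≡ 0F ⊎ i ≡ 1F → 3 ≤ weight 0F + weight 1F + weight 2F
  window (inj₁ refl) = +-mono-≤ (≤-trans (1≤weight λ ()) (m≤n+m _ (weight 0F))) (2≤weight ≤-refl)
  window (inj₂ refl) = +-mono-≤ (2≤weight+weight (λ ()) (λ r d → toℕ-injective d)) (1≤weight λ ())

lemma3 : (m n : ℕ) → 3 ≤ m → 3 ≤ n → (D : VSet m n) → TwoDominating D →
    (j : Fin n) → (j- j+ : Fin n) → toℕ j- + 1 ≡ toℕ j → toℕ j + 1 ≡ toℕ j+ →
    (i : Fin m) →
    (toℕ i ≡ 0 ⊎ toℕ i ≡ 1 ⊎ toℕ i + 2 ≡ m ⊎ toℕ i + 1 ≡ m) →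
    ((i' : Fin m) → (D i' j ≡ true → i' ≡ i) × (i' ≡ i → D i' j ≡ true)) →
    2 * m ∸ 3 ≤ c D j- + c D j+
lemma3 m n (s≤s (s≤s (s≤s _))) _ D dom j j- j+ j-+1≡j j+1≡j+ i i-boundary column =
  from-boundary-row i-boundary
  where
  only : ColumnMeetsOnly D j i
  only i' = proj₁ (column i')

  top : i ≡ 0F ⊎ i ≡ 1F → 2 * m ∸ 3 ≤ c D j- + c D j+
  top i-top = bound-for-top-rows dom j-+1≡j j+1≡j+ i-top only

  bottom : opposite i ≡ 0F ⊎ opposite i ≡ 1F → 2 * m ∸ 3 ≤ c D j- + c D j+
  bottom i-bottom = subst₂ (λ a b → 2 * m ∸ 3 ≤ a + b) (c-reflectRows D j-) (c-reflectRows D j+)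
    (bound-for-top-rows (reflectRows-TwoDominating dom) j-+1≡j j+1≡j+ i-bottom
      (reflectRows-ColumnMeetsOnly {D = D} only))

  from-boundary-row : toℕ i ≡ 0 ⊎ toℕ i ≡ 1 ⊎ toℕ i + 2 ≡ m ⊎ toℕ i + 1 ≡ m →
    2 * m ∸ 3 ≤ c D j- + c D j+
  from-boundary-row (inj₁ i≡0)               = top (inj₁ (toℕ-injective i≡0))
  from-boundary-row (inj₂ (inj₁ i≡1))        = top (inj₂ (toℕ-injective i≡1))
  from-boundary-row (inj₂ (inj₂ (inj₁ i+2≡m))) = bottom (inj₂ (toℕ-injective (toℕ-opposite i i+2≡m)))
  from-boundary-row (inj₂ (inj₂ (inj₂ i+1≡m))) = bottom (inj₁ (toℕ-injective (toℕ-opposite i i+1≡m)))
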